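{- Every axiomatic class of CK-frames is closed under taking disjoint unions, generated subframes and bounded morphic images.
   Context: Formulas: $\phi::=p\mid\bot\mid\phi\wedge\phi\mid\phi\vee\phi\mid\phi\to\phi\mid\Box\phi\mid\Diamond\phi$ over a set $\mathrm{Prop}$. $\mathsf{CK}$ is axiomatized by intuitionistic propositional logic plus $\Box(\phi\to\psi)\to(\Box\phi\to\Box\psi)$ and $\Box(\phi\to\psi)\to(\Diamond\phi\to\Diamond\psi)$, with modus ponens and necessitation; $\mathsf{CK}\oplus\mathsf{Ax}$ adds all substitution instances of formulas of $\mathsf{Ax}$ as axioms. A CK-frame is $(X,\text{bomb},\le,R)$, $\le$ a preorder, $\text{bomb}$ $\le$-maximal, $\text{bomb}\,R\,x$ iff $x=\text{bomb}$. $\mathrm{Up}(X)$ = $\le$-upsets containing $\text{bomb}$. Valuations $V:\mathrm{Prop}\to\mathrm{Up}(X)$ extend by $V(\bot)=\{\text{bomb}\}$, $\wedge\mapsto\cap$, $\vee\mapsto\cup$, $V(\phi\to\psi)=\{x:\forall y(x\le y,y\in V(\phi)\Rightarrow y\in V(\psi))\}$, $V(\Box\phi)=\{x:\forall y,z(x\le yRz\Rightarrow z\in V(\phi))\}$, $V(\Diamond\phi)=\{x:\forall y(x\le y\Rightarrow\exists z(yRz,z\in V(\phi)))\}$; $\mathcal{X}\Vdash\phi$ iff $V(\phi)=X$ for all $V$. A class of CK-frames is axiomatic if for some set $\mathsf{Ax}$ it equals the class of all CK-frames validating every theorem of $\mathsf{CK}\oplus\mathsf{Ax}$. Bounded morphism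 $f:\mathcal{X}\to\mathcal{X}'$: $f(x)=\text{bomb}'$ iff $x=\text{bomb}$; $x\le y\Rightarrow f(x)\le'f(y)$; $f(x)\le'z'\Rightarrow\exists z(x\le z,f(z)=z')$; $xRy\Rightarrow f(x)R'f(y)$; $f(x)R'z'\Rightarrow\exists z(xRz,f(z)=z')$. A bounded morphic image of $\mathcal{X}$ is a CK-frame $\mathcal{X}'$ admitting a surjective bounded morphism $\mathcal{X}\to\mathcal{X}'$. A generated subframe of $\mathcal{X}$ is $(X',\text{bomb},\le',R')$ with $\text{bomb}\in X'\subseteq X$, $X'$ upward closed under $\le$ and $R$, and $\le',R'$ the restrictions. The disjoint union of CK-frames $\mathcal{X}_i=(X_i,\text{bomb}_i,\le_i,R_i)$, $i\in I$, has worlds $\{(i,x):x\in X_i\setminus\{\text{bomb}_i\}\}\cup\{\text{bomb}\}$ with $(i,x)\le(j,y)$ iff $i=j$, $x\le_iy$; $(i,x)\le\text{bomb}$ iff $x\le_i\text{bomb}_i$; $\text{bomb}\le\text{bomb}$; $(i,x)R(j,y)$ iff $i=j$, $xR_iy$; $(i,x)R\,\text{bomb}$ iff $xR_i\text{bomb}_i$; $\text{bomb}\,R\,\text{bomb}$. -}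

module Defs where

open import Level using (Level; _⊔_) renaming (suc to lsuc; zero to lzero)
open import Data.Unit using (⊤; tt)
open import Data.Empty using (⊥)
open import Data.Product using (Σ; _×_; _,_; proj₁; proj₂; Σ-syntax)
open import Data.Sum using (_⊎_; inj₁; inj₂)
open import Data.Irrelevant using ([_])
open import Data.Refinement using (Refinement; _,_; value)
open import Relation.Nullary using (¬_)
open import Relation.Binary.PropositionalEquality using (_≡_; refl)
open import Function.Bundles using (_⇔_)

infixr 6 _∧'_
infixr 5 _∨'_
infixr 4 _⇒'_

data Form (P : Set) : Set where
  var   : P → Form P
  ⊥'    : Form P
  _∧'_  : Form P → Form P → Form P
  _∨'_  : Form P → Form P → Form P
  _⇒'_  : Form P → Form P → Form P
  □'    : Form P → Form P
  ◇'    : Form P → Form P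

subst-form : {P : Set} → (P → Form P) → Form P → Form P
subst-form σ (var p)  = σ p
subst-form σ ⊥'       = ⊥'
subst-form σ (φ ∧' ψ) = subst-form σ φ ∧' subst-form σ ψ
subst-form σ (φ ∨' ψ) = subst-form σ φ ∨' subst-form σ ψ
subst-form σ (φ ⇒' ψ) = subst-form σ φ ⇒' subst-form σ ψ
subst-form σ (□' φ)   = □' (subst-form σ φ)
subst-form σ (◇' φ)   = ◇' (subst-form σ φ)

data Thm {P : Set} (Ax : Form P → Set) : Form P → Set where
  ax-K   : ∀ {φ ψ} → Thm Ax (φ ⇒' (ψ ⇒' φ))
  ax-S   : ∀ {φ ψ χ} → Thm Ax ((φ ⇒' (ψ ⇒' χ)) ⇒' ((φ ⇒' ψ) ⇒' (φ ⇒' χ)))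
  ax-∧₁  : ∀ {φ ψ} → Thm Ax ((φ ∧' ψ) ⇒' φ)
  ax-∧₂  : ∀ {φ ψ} → Thm Ax ((φ ∧' ψ) ⇒' ψ)
  ax-∧I  : ∀ {φ ψ} → Thm Ax (φ ⇒' (ψ ⇒' (φ ∧' ψ)))
  ax-∨₁  : ∀ {φ ψ} → Thm Ax (φ ⇒' (φ ∨' ψ))
  ax-∨₂  : ∀ {φ ψ} → Thm Ax (ψ ⇒' (φ ∨' ψ))
  ax-∨E  : ∀ {φ ψ χ} → Thm Ax ((φ ⇒' χ) ⇒' ((ψ ⇒' χ) ⇒' ((φ ∨' ψ) ⇒' χ)))
  ax-⊥   : ∀ {φ} → Thm Ax (⊥' ⇒' φ)
  ax-K□  : ∀ {φ ψ} → Thm Ax (□' (φ ⇒' ψ) ⇒' (□' φ ⇒' □' ψ))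
  ax-K◇  : ∀ {φ ψ} → Thm Ax (□' (φ ⇒' ψ) ⇒' (◇' φ ⇒' ◇' ψ))
  ax-Ax  : ∀ {φ} (σ : P → Form P) → Ax φ → Thm Ax (subst-form σ φ)
  mp     : ∀ {φ ψ} → Thm Ax (φ ⇒' ψ) → Thm Ax φ → Thm Ax ψ
  nec    : ∀ {φ} → Thm Ax φ → Thm Ax (□' φ)

record Frame : Set₁ where
  field
    Carrier   : Set
    bomb      : Carrier
    _≤_       : Carrier → Carrier → Set
    R         : Carrier → Carrier → Set
    ≤-refl    : ∀ {x} → x ≤ x
    ≤-trans   : ∀ {x y z} → x ≤ y → y ≤ z → x ≤ z
    bomb-max  : ∀ {y} → bomb ≤ y → y ≡ bomb
    bomb-R→   : ∀ {x} → R bomb x → x ≡ bomb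
    bomb-R←   : R bomb bomb
open Frame public

Up : Frame → Set₁
Up X = Σ[ U ∈ (Carrier X → Set) ]
         ((∀ {x y} → _≤_ X x y → U x → U y) × U (bomb X))

Valuation : Set → Frame → Set₁
Valuation P X = P → Up X

Sat : {P : Set} (X : Frame) → Valuation P X → Carrier X → Form P → Set
Sat X V x (var p)  = proj₁ (V p) x
Sat X V x ⊥'       = x ≡ bomb X
Sat X V x (φ ∧' ψ) = Sat X V x φ × Sat X V x ψ
Sat X V x (φ ∨' ψ) = Sat X V x φ ⊎ Sat X V x ψ
Sat X V x (φ ⇒' ψ) = ∀ y → _≤_ X x y → Sat X V y φ → Sat X V y ψ
Sat X V x (□' φ)   = ∀ y z → _≤_ X x y → R X y z → Sat X V z φ
Sat X V x (◇' φ)   = ∀ y → _≤_ X x y → Σ[ z ∈ Carrier X ] (R X y z × Sat X V z φ)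

Valid : {P : Set} → Frame → Form P → Set₁
Valid {P} X φ = (V : Valuation P X) → ∀ x → Sat X V x φ

Axiomatic : {ℓ : Level} (P : Set) → (Frame → Set ℓ) → Set (lsuc lzero ⊔ ℓ)
Axiomatic P C =
  Σ[ Ax ∈ (Form P → Set) ]
    (∀ X → C X ⇔ (∀ φ → Thm Ax φ → Valid X φ))

record IsBoundedMorphism (X Y : Frame) (f : Carrier X → Carrier Y) : Set where
  field
    bomb→   : ∀ {x} → f x ≡ bomb Y → x ≡ bomb X
    bomb←   : f (bomb X) ≡ bomb Y
    mono    : ∀ {x y} → _≤_ X x y → _≤_ Y (f x) (f y)
    ≤-back  : ∀ {x z'} → _≤_ Y (f x) z' → Σ[ z ∈ Carrier X ] (_≤_ X x z × f z ≡ z')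
    R-forth : ∀ {x y} → R X x y → R Y (f x) (f y)
    R-back  : ∀ {x z'} → R Y (f x) z' → Σ[ z ∈ Carrier X ] (R X x z × f z ≡ z')

Surjective : {A B : Set} → (A → B) → Set
Surjective {A} f = ∀ b → Σ[ a ∈ A ] (f a ≡ b)

record IsGenerated (X : Frame) (S : Carrier X → Set) : Set where
  field
    has-bomb : S (bomb X)
    ≤-closed : ∀ {x y} → _≤_ X x y → S x → S y
    R-closed : ∀ {x y} → R X x y → S x → S y

-- Subsets are taken proof-irrelevantly (Refinement), so worlds of the
-- subframe are equal iff the underlying worlds are equal.
Subframe : (X : Frame) (S : Carrier X → Set) → IsGenerated X S → Frame
Subframe X S g = record
  { Carrier  = Refinement (Carrier X) S
  ; bomb     = bomb X , [ IsGenerated.has-bomb g ]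
  ; _≤_      = λ a b → _≤_ X (value a) (value b)
  ; R        = λ a b → R X (value a) (value b)
  ; ≤-refl   = ≤-refl X
  ; ≤-trans  = ≤-trans X
  ; bomb-max = λ { {y , _} p → lemma (bomb-max X p) }
  ; bomb-R→  = λ { {y , _} p → lemma (bomb-R→ X p) }
  ; bomb-R←  = bomb-R← X
  }
  where
  lemma : ∀ {y} .{h : S y} .{h' : S (bomb X)} → y ≡ bomb X →
          _≡_ {A = Refinement (Carrier X) S} (y , [ h ]) (bomb X , [ h' ])
  lemma refl = refl

module _ (I : Set) (Xs : I → Frame) where

  -- (i , x) with x ≠ bomb_i, or the new bomb
  DUCarrier : Set
  DUCarrier = ⊤ ⊎ Refinement (Σ[ i ∈ I ] Carrier (Xs i)) (λ ix → ¬ (proj₂ ix ≡ bomb (Xs (proj₁ ix))))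

  data DU≤ : DUCarrier → DUCarrier → Set where
    in-in     : ∀ {i x y} .{hx hy} → _≤_ (Xs i) x y →
                DU≤ (inj₂ ((i , x) , [ hx ])) (inj₂ ((i , y) , [ hy ]))
    in-bomb   : ∀ {i x} .{hx} → _≤_ (Xs i) x (bomb (Xs i)) →
                DU≤ (inj₂ ((i , x) , [ hx ])) (inj₁ tt)
    bomb-bomb : DU≤ (inj₁ tt) (inj₁ tt)

  data DUR : DUCarrier → DUCarrier → Set where
    in-in     : ∀ {i x y} .{hx hy} → R (Xs i) x y →
                DUR (inj₂ ((i , x) , [ hx ])) (inj₂ ((i , y) , [ hy ]))
    in-bomb   : ∀ {i x} .{hx} → R (Xs i) x (bomb (Xs i)) →
                DUR (inj₂ ((i , x) , [ hx ])) (inj₁ tt)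
    bomb-bomb : DUR (inj₁ tt) (inj₁ tt)

  private
    du-refl : ∀ {x} → DU≤ x x
    du-refl {inj₁ tt} = bomb-bomb
    du-refl {inj₂ ((i , x) , [ h ])} = in-in (≤-refl (Xs i))

    du-trans : ∀ {x y z} → DU≤ x y → DU≤ y z → DU≤ x z
    du-trans {inj₂ ((i , _) , _)} (in-in p) (in-in q) = in-in (≤-trans (Xs i) p q)
    du-trans {inj₂ ((i , _) , _)} (in-in p) (in-bomb q) = in-bomb (≤-trans (Xs i) p q)
    du-trans (in-bomb p) bomb-bomb = in-bomb p
    du-trans bomb-bomb bomb-bomb = bomb-bomb

    du-max : ∀ {y} → DU≤ (inj₁ tt) y → y ≡ inj₁ tt
    du-max bomb-bomb = refl

    du-R→ : ∀ {y} → DUR (inj₁ tt) y → y ≡ inj₁ tt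
    du-R→ bomb-bomb = refl

  DisjointUnion : Frame
  DisjointUnion = record
    { Carrier  = DUCarrier
    ; bomb     = inj₁ tt
    ; _≤_      = DU≤
    ; R        = DUR
    ; ≤-refl   = du-refl
    ; ≤-trans  = du-trans
    ; bomb-max = du-max
    ; bomb-R→  = du-R→
    ; bomb-R←  = bomb-bomb
    }

{-# OPTIONS --safe #-}
-- A bounded morphism f : X → Y preserves and reflects truth between valuations that agree
-- along f.  A surjective bounded morphism, the inclusion of a generated subframe and the
-- embedding of each summand into a disjoint union are bounded morphisms, so every formula
-- valid on the source frame(s) is valid on the constructed frame: on a morphic image by
-- pulling valuations back, on a generated subframe by extending them, and on a disjoint union
-- because every world other than bomb lies in the image of some summand.  An axiomatic class
-- is the class of frames validating a fixed set of formulas, hence it is closed under all three.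
module Submission where

open import Defs
open import Level using (Level)
open import Data.Product using (Σ-syntax; _×_; _,_; proj₁; proj₂)
open import Data.Sum using (inj₁; inj₂)
open import Data.Unit using (⊤; tt)
open import Data.Empty using (⊥-elim; ⊥-elim-irr)
open import Data.Irrelevant using ([_])
open import Data.Refinement using (value; _,_)
open import Function using (id)
open import Function.Bundles using (_⇔_; mk⇔; Equivalence)
open import Relation.Nullary using (Dec; yes; no; ¬_)
open import Relation.Binary.PropositionalEquality using (_≡_; refl; sym; trans; cong; subst)

bomb-sat : {P : Set} (X : Frame) (V : Valuation P X) (φ : Form P) → Sat X V (bomb X) φ
bomb-sat X V (var p)  = proj₂ (proj₂ (V p))
bomb-sat X V ⊥'       = refl
bomb-sat X V (φ ∧' ψ) = bomb-sat X V φ , bomb-sat X V ψ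
bomb-sat X V (φ ∨' ψ) = inj₁ (bomb-sat X V φ)
bomb-sat X V (φ ⇒' ψ) y le _ with refl ← bomb-max X le = bomb-sat X V ψ
bomb-sat X V (□' φ) y z le r with refl ← bomb-max X le with refl ← bomb-R→ X r = bomb-sat X V φ
bomb-sat X V (◇' φ) y le with refl ← bomb-max X le = bomb X , bomb-R← X , bomb-sat X V φ

AgreeAlong : {P : Set} {X Y : Frame} → (Carrier X → Carrier Y) →
             Valuation P X → Valuation P Y → Set
AgreeAlong {X = X} f V V' = ∀ p (x : Carrier X) → proj₁ (V p) x ⇔ proj₁ (V' p) (f x)

module _ {P : Set} {X Y : Frame} {f : Carrier X → Carrier Y} (bm : IsBoundedMorphism X Y f)
         {V : Valuation P X} {V' : Valuation P Y} (agree : AgreeAlong {X = X} {Y} f V V') where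
  open IsBoundedMorphism bm

  sat-forth : ∀ x φ → Sat X V x φ → Sat Y V' (f x) φ
  sat-back  : ∀ x φ → Sat Y V' (f x) φ → Sat X V x φ

  sat-forth x (var p)  s        = Equivalence.to (agree p x) s
  sat-forth x ⊥'       e        = trans (cong f e) bomb←
  sat-forth x (φ ∧' ψ) (s , t)  = sat-forth x φ s , sat-forth x ψ t
  sat-forth x (φ ∨' ψ) (inj₁ s) = inj₁ (sat-forth x φ s)
  sat-forth x (φ ∨' ψ) (inj₂ t) = inj₂ (sat-forth x ψ t)
  sat-forth x (φ ⇒' ψ) k _ le s with ≤-back le
  ... | y , x≤y , refl = sat-forth y ψ (k y x≤y (sat-back y φ s))
  sat-forth x (□' φ) k _ _ le r with ≤-back le
  ... | y , x≤y , refl with R-back r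
  ... | z , yRz , refl = sat-forth z φ (k y z x≤y yRz)
  sat-forth x (◇' φ) k _ le with ≤-back le
  ... | y , x≤y , refl with k y x≤y
  ... | z , yRz , s = f z , R-forth yRz , sat-forth z φ s

  sat-back x (var p)  s        = Equivalence.from (agree p x) s
  sat-back x ⊥'       e        = bomb→ e
  sat-back x (φ ∧' ψ) (s , t)  = sat-back x φ s , sat-back x ψ t
  sat-back x (φ ∨' ψ) (inj₁ s) = inj₁ (sat-back x φ s)
  sat-back x (φ ∨' ψ) (inj₂ t) = inj₂ (sat-back x ψ t)
  sat-back x (φ ⇒' ψ) k y le s = sat-back y ψ (k (f y) (mono le) (sat-forth y φ s))
  sat-back x (□' φ) k y z le r = sat-back z φ (k (f y) (f z) (mono le) (R-forth r))
  sat-back x (◇' φ) k y le with k (f y) (mono le)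
  ... | _ , r , s with R-back r
  ... | z , yRz , refl = z , yRz , sat-back z φ s

pullback : {P : Set} {X Y : Frame} {f : Carrier X → Carrier Y} →
           IsBoundedMorphism X Y f → Valuation P Y → Valuation P X
pullback {f = f} bm V' p =
  (λ x → proj₁ (V' p) (f x)) ,
  (λ le → proj₁ (proj₂ (V' p)) (mono le)) ,
  subst (proj₁ (V' p)) (sym bomb←) (proj₂ (proj₂ (V' p)))
  where open IsBoundedMorphism bm

valid-on-image : {P : Set} {X Y : Frame} {f : Carrier X → Carrier Y} →
                 IsBoundedMorphism X Y f → (φ : Form P) → Valid X φ →
                 (V' : Valuation P Y) (x : Carrier X) → Sat Y V' (f x) φ
valid-on-image bm φ valid V' x =
  sat-forth bm {V = pullback bm V'} (λ _ _ → mk⇔ id id) x φ (valid (pullback bm V') x)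

valid-boundedMorphicImage : {P : Set} {X Y : Frame} {f : Carrier X → Carrier Y} →
                            IsBoundedMorphism X Y f → Surjective f →
                            (φ : Form P) → Valid X φ → Valid Y φ
valid-boundedMorphicImage bm surj φ valid V' y with surj y
... | x , refl = valid-on-image bm φ valid V' x

module _ {X : Frame} {S : Carrier X → Set} (g : IsGenerated X S) where
  open IsGenerated g

  inclusion-isBoundedMorphism : IsBoundedMorphism (Subframe X S g) X value
  inclusion-isBoundedMorphism = record
    { bomb→   = λ { {_ , _} refl → refl }
    ; bomb←   = refl
    ; mono    = id
    ; ≤-back  = λ { {_ , [ h ]} {y} le → (y , [ ≤-closed le h ]) , le , refl }
    ; R-forth = id
    ; R-back  = λ { {_ , [ h ]} {y} r → (y , [ R-closed r h ]) , r , refl }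
    }

  -- Membership proofs in the subframe are irrelevant, so x ∈ S cannot be recovered from a
  -- world (x , [ h ]); the extension therefore asks for a world of the subframe over x.
  extend : {P : Set} → Valuation P (Subframe X S g) → Valuation P X
  extend V p =
    (λ x → Σ[ s ∈ Carrier (Subframe X S g) ] (value s ≡ x × proj₁ (V p) s)) ,
    (λ { {y = y} le ((_ , [ h ]) , refl , u) →
           (y , [ ≤-closed le h ]) , refl , proj₁ (proj₂ (V p)) le u }) ,
    (bomb (Subframe X S g) , refl , proj₂ (proj₂ (V p)))

  extend-agree : {P : Set} (V : Valuation P (Subframe X S g)) →
                 AgreeAlong {X = Subframe X S g} {X} value V (extend V)
  extend-agree V p s = mk⇔ (λ u → s , refl , u) λ { ((_ , _) , refl , u) → u }

  valid-generatedSubframe : {P : Set} (φ : Form P) → Valid X φ → Valid (Subframe X S g) φ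
  valid-generatedSubframe φ valid V s =
    sat-back inclusion-isBoundedMorphism (extend-agree V) s φ (valid (extend V) (value s))

module _ (dec : (A : Set) → Dec A) {I : Set} (Xs : I → Frame) (i : I) where
  private
    X = Xs i
    D = DisjointUnion I Xs

  inject : Carrier X → Carrier D
  inject x with dec (x ≡ bomb X)
  ... | yes _ = inj₁ tt
  ... | no x≢bomb = inj₂ ((i , x) , [ x≢bomb ])

  inject-bomb : ∀ {x} → x ≡ bomb X → inject x ≡ inj₁ tt
  inject-bomb {x} x≡bomb with dec (x ≡ bomb X)
  ... | yes _ = refl
  ... | no x≢bomb = ⊥-elim (x≢bomb x≡bomb)

  inject-nonbomb : ∀ {x} .(x≢bomb : ¬ x ≡ bomb X) → inject x ≡ inj₂ ((i , x) , [ x≢bomb ])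
  inject-nonbomb {x} x≢bomb with dec (x ≡ bomb X)
  ... | yes x≡bomb = ⊥-elim-irr (x≢bomb x≡bomb)
  ... | no _ = refl

  inject-isBoundedMorphism : IsBoundedMorphism X D inject
  inject-isBoundedMorphism = record
    { bomb→   = bomb→
    ; bomb←   = inject-bomb refl
    ; mono    = mono
    ; ≤-back  = ≤-back
    ; R-forth = R-forth
    ; R-back  = R-back
    }
    where
    bomb→ : ∀ {x} → inject x ≡ inj₁ tt → x ≡ bomb X
    bomb→ {x} e with dec (x ≡ bomb X)
    bomb→ e | yes x≡bomb = x≡bomb
    bomb→ () | no _

    mono : ∀ {x y} → _≤_ X x y → DU≤ I Xs (inject x) (inject y)
    mono {x} {y} le with dec (x ≡ bomb X) | dec (y ≡ bomb X)
    ... | yes _ | yes _ = bomb-bomb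
    ... | yes refl | no y≢bomb = ⊥-elim (y≢bomb (bomb-max X le))
    ... | no _ | yes refl = in-bomb le
    ... | no _ | no _ = in-in le

    R-forth : ∀ {x y} → R X x y → DUR I Xs (inject x) (inject y)
    R-forth {x} {y} r with dec (x ≡ bomb X) | dec (y ≡ bomb X)
    ... | yes _ | yes _ = bomb-bomb
    ... | yes refl | no y≢bomb = ⊥-elim (y≢bomb (bomb-R→ X r))
    ... | no _ | yes refl = in-bomb r
    ... | no _ | no _ = in-in r

    ≤-back : ∀ {x z'} → DU≤ I Xs (inject x) z' → Σ[ z ∈ Carrier X ] (_≤_ X x z × inject z ≡ z')
    ≤-back {x} le with dec (x ≡ bomb X)
    ≤-back bomb-bomb | yes refl = bomb X , ≤-refl X , inject-bomb refl
    ≤-back (in-in {y = y} {hy = y≢bomb} le) | no _ = y , le , inject-nonbomb y≢bomb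
    ≤-back (in-bomb le) | no _ = bomb X , le , inject-bomb refl

    R-back : ∀ {x z'} → DUR I Xs (inject x) z' → Σ[ z ∈ Carrier X ] (R X x z × inject z ≡ z')
    R-back {x} r with dec (x ≡ bomb X)
    R-back bomb-bomb | yes refl = bomb X , bomb-R← X , inject-bomb refl
    R-back (in-in {y = y} {hy = y≢bomb} r) | no _ = y , r , inject-nonbomb y≢bomb
    R-back (in-bomb r) | no _ = bomb X , r , inject-bomb refl

valid-disjointUnion : ((A : Set) → Dec A) → {P : Set} (I : Set) (Xs : I → Frame) →
                      (φ : Form P) → (∀ i → Valid (Xs i) φ) → Valid (DisjointUnion I Xs) φ
valid-disjointUnion dec I Xs φ valid V (inj₁ tt) = bomb-sat (DisjointUnion I Xs) V φ
valid-disjointUnion dec I Xs φ valid V (inj₂ ((i , x) , [ x≢bomb ])) =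
  subst (λ w → Sat (DisjointUnion I Xs) V w φ) (inject-nonbomb dec Xs i x≢bomb)
        (valid-on-image (inject-isBoundedMorphism dec Xs i) φ (valid i) V x)

axiomatic-closed : ∀ {ℓ} {P : Set} {C : Frame → Set ℓ} → Axiomatic P C →
                   {I : Set} (Xs : I → Frame) (Y : Frame) →
                   (∀ (φ : Form P) → (∀ i → Valid (Xs i) φ) → Valid Y φ) →
                   (∀ i → C (Xs i)) → C Y
axiomatic-closed (_ , characterisation) Xs Y transfer inC =
  Equivalence.from (characterisation Y) λ φ ⊢φ →
    transfer φ λ i → Equivalence.to (characterisation (Xs i)) (inC i) φ ⊢φ

proposition2p24 :
    -- the ambient metatheory of the paper is classical
    ((A : Set) → Dec A) →
    ∀ {ℓ : Level} (P : Set) (C : Frame → Set ℓ) → Axiomatic P C →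
    -- closed under disjoint unions
    ((I : Set) (Xs : I → Frame) → (∀ i → C (Xs i)) → C (DisjointUnion I Xs))
    -- closed under generated subframes
    × ((X : Frame) (S : Carrier X → Set) (g : IsGenerated X S) → C X → C (Subframe X S g))
    -- closed under bounded morphic images
    × ((X Y : Frame) (f : Carrier X → Carrier Y) → IsBoundedMorphism X Y f → Surjective f →
        C X → C Y)
proposition2p24 dec P C axiomatic =
    (λ I Xs → axiomatic-closed axiomatic Xs (DisjointUnion I Xs) (valid-disjointUnion dec I Xs))
  , (λ X S g → closed X (Subframe X S g) (valid-generatedSubframe g))
  , (λ X Y f bm surj → closed X Y (valid-boundedMorphicImage bm surj))
  where
  closed : (X Y : Frame) → (∀ (φ : Form P) → Valid X φ → Valid Y φ) → C X → C Y
  closed X Y transfer inC =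
    axiomatic-closed axiomatic (λ (_ : ⊤) → X) Y (λ φ valid → transfer φ (valid tt)) (λ _ → inC)
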